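{- Let $T$ be a tree with vertex set $\{1,\ldots,n\}$, $n\ge2$, let $\sigma=e_1e_2\cdots e_{n-1}$ be an ordering of its edges, and let $g\in S_n$ be the product of the corresponding transpositions. Fix a vertex $i$, and form the closed walk obtained by concatenating, for $k=1,\ldots,n$, the edge sequences of the unique paths in $T$ from $ig^{k-1}$ to $ig^{k}$. Then every edge of $T$ occurs exactly twice in this walk.
   Context: Each edge $\{u,v\}$ is regarded as the transposition $(u,v)$; permutations act on the right and products are composed left to right, so $x(gh)=(xg)h$. The product $g$ is an $n$-cycle, so $ig^n=i$ and the walk is closed and visits the vertices in the order of the cycle $g$; this walk is called the traversal of $T$ with respect to $\sigma$. -}

module Defs where

open import Data.Nat using (ℕ; zero; suc; _∸_; _≤_)
open import Data.Fin using (Fin; zero; suc; toℕ)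
open import Data.Fin.Permutation using (Permutation′; transpose; _∘ₚ_; _⟨$⟩ʳ_)
import Data.Fin.Permutation as Perm
open import Data.Product using (_×_; _,_; proj₁; proj₂; Σ; ∃)
open import Data.Sum using (_⊎_)
open import Data.List using (List; []; _∷_; _++_; map; concat; allFin; length; filter)
open import Data.List.Relation.Unary.Unique.Propositional using (Unique)
open import Data.Nat.GeneralisedArithmetic using (iterate)
open import Relation.Binary.PropositionalEquality using (_≡_; _≢_)
open import Relation.Nullary using (¬_)

-- An edge-ordered graph on vertex set Fin n with m edges:
-- σ k is the (k+1)-st edge e_{k+1} = {u , v}, given as an ordered pair of its endpoints.
EdgeSeq : ℕ → ℕ → Set
EdgeSeq n m = Fin m → Fin n × Fin n

module _ {n m : ℕ} (σ : EdgeSeq n m) where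

  Joins : Fin m → Fin n → Fin n → Set
  Joins j u w = (σ j ≡ (u , w)) ⊎ (σ j ≡ (w , u))

  Adjacent : Fin n → Fin n → Set
  Adjacent u w = ∃ λ j → Joins j u w

  Simple : Set
  Simple = (∀ j → proj₁ (σ j) ≢ proj₂ (σ j))
         × (∀ j k → Joins j (proj₁ (σ k)) (proj₂ (σ k)) → j ≡ k)

  data Walk : Fin n → Fin n → Set where
    [] : ∀ {u} → Walk u u
    step : ∀ {u w v} (j : Fin m) → Joins j u w → Walk w v → Walk u v

  edgesOf : ∀ {u v} → Walk u v → List (Fin m)
  edgesOf [] = []
  edgesOf (step j _ p) = j ∷ edgesOf p

  verticesOf : ∀ {u v} → Walk u v → List (Fin n)
  verticesOf {u} [] = u ∷ []
  verticesOf {u} (step _ _ p) = u ∷ verticesOf p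

  IsPath : ∀ {u v} → Walk u v → Set
  IsPath p = Unique (verticesOf p)

  Connected : Set
  Connected = ∀ u v → Σ (Walk u v) IsPath

  record Cycle : Set where
    field
      len : ℕ
      len≥3 : 3 ≤ len
      c : Fin len → Fin n
      distinct : ∀ a b → c a ≡ c b → a ≡ b
      consecutive : ∀ (a b : Fin len) → suc (toℕ a) ≡ toℕ b → Adjacent (c a) (c b)
      closing : ∀ (a b : Fin len) → suc (toℕ a) ≡ len → toℕ b ≡ 0 → Adjacent (c a) (c b)

  Acyclic : Set
  Acyclic = ¬ Cycle

  IsTree : Set
  IsTree = Simple × Connected × Acyclic

  edgeTransposition : Fin m → Perm.Permutation′ n
  edgeTransposition j = transpose (proj₁ (σ j)) (proj₂ (σ j))

  -- g = e_1 e_2 ... e_m, composed left to right (π₁ ∘ₚ π₂ applies π₁ first),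
  -- acting on the right: x g = (...((x e_1) e_2)...) e_m
  productFrom : List (Fin m) → Perm.Permutation′ n
  productFrom [] = Perm.id
  productFrom (j ∷ js) = edgeTransposition j ∘ₚ productFrom js

  product : Perm.Permutation′ n
  product = productFrom (allFin m)

  actPow : Fin n → ℕ → Fin n
  actPow x k = iterate (product ⟨$⟩ʳ_) x k

occurrences : ∀ {m} → Fin m → List (Fin m) → ℕ
occurrences j xs = length (filter (Data.Fin._≟_ j) xs)

module Submission where

-- For an edge e, colour each vertex by the component of T − e containing it (side e). A path of T
-- uses e exactly when its endpoints have different colours, so the k-th path contributes one
-- occurrence of e exactly when i g^k and i g^(k+1) have different colours. As g is an n-cycle, i g^k
-- runs through all vertices, so the count is the number of x whose colour differs from that of x g.
-- Peeling off the transpositions of g one at a time, every transposition other than e preserves the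
-- colouring and does not change this number, while the transposition of e alone changes exactly the
-- colours of its two endpoints: the count is 2.
-- That g is an n-cycle uses the same colourings. Write g = t h, t the transposition of the first edge
-- uv (applied first); h preserves the sides of uv. If s is g-invariant, then s and s ∘ h have equally
-- many points on the side of u and can differ there only at u, where s ∘ h takes the value s(v).
-- Hence s(u) = s(v) and s is h-invariant; inductively s is constant on every edge, hence constant.

open import Defs
open import Data.Bool using (Bool; true; false; not; _xor_; _∧_)
open import Data.Bool.Properties
  using (∧-identityʳ; ∧-zeroʳ; not-¬; not-involutive; not-distribˡ-xor; not-distribʳ-xor; xor-same)
open import Data.Empty using (⊥; ⊥-elim)
open import Data.Fin using (Fin; zero; suc; toℕ; _≟_; punchIn; punchOut; fromℕ<; inject≤)
open import Data.Fin.Permutation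
  using (Permutation′; transpose; _∘ₚ_; _⟨$⟩ʳ_; _⟨$⟩ˡ_; inverseˡ; inverseʳ; permutation)
open import Data.Fin.Properties
  using (punchInᵢ≢i; punchIn-punchOut; punchIn-injective; any?; pigeonhole; toℕ-fromℕ<; toℕ-inject≤;
         toℕ≤pred[n]; toℕ<n; <-cmp; injective⇒≤)
open import Data.List using (List; []; _∷_; _++_; concat; map; tabulate; allFin; length; filter; lookup)
open import Data.List.Membership.Propositional using (_∈_; _∉_)
open import Data.List.Membership.Propositional.Properties using (∈-lookup; ∈-++⁻; ∈-allFin)
open import Data.List.Properties using (filter-++; filter-none; length-++; map-tabulate)
open import Data.List.Relation.Binary.Subset.Propositional using (_⊆_)
open import Data.List.Relation.Unary.All as All using (All; []; _∷_)
open import Data.List.Relation.Unary.All.Properties using (¬Any⇒All¬)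
open import Data.List.Relation.Unary.AllPairs using ([]; _∷_)
open import Data.List.Relation.Unary.Any using (here; there)
import Data.List.Relation.Unary.Any as Any
open import Data.List.Relation.Unary.Unique.Propositional using (Unique)
open import Data.List.Relation.Unary.Unique.Propositional.Properties using (allFin⁺)
open import Data.Nat using (ℕ; zero; suc; _+_; _*_; _∸_; _≤_; _<_; z≤n; s≤s)
open import Data.Nat.DivMod using (_%_; _/_; m≡m%n+[m/n]*n; m%n<n)
open import Data.Nat.GeneralisedArithmetic using (iterate)
open import Data.Nat.Properties
  using (+-0-commutativeMonoid; +-comm; +-cancelʳ-≡; suc-injective; 0≢1+n; m≤n+m; n<1+n;
         ≤-reflexive; ≤-trans; ≤-<-trans; <-irrefl; m≤n⇒∃[o]m+o≡n)
open import Algebra.Properties.CommutativeMonoid.Sum +-0-commutativeMonoid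
  using (sum; sum-cong-≗; sum-remove; sum-permute; sum-replicate-zero)
open import Data.Product using (Σ; ∃; _×_; _,_; proj₁; proj₂; uncurry)
open import Data.Sum using (_⊎_; inj₁; inj₂)
open import Function using (id; _∘_)
open import Function.Bundles using (mk⇔)
open import Relation.Binary.Definitions using (tri<; tri≈; tri>)
open import Relation.Binary.PropositionalEquality
  using (_≡_; _≢_; refl; sym; trans; cong; cong₂; subst; subst₂; module ≡-Reasoning)
open import Relation.Nullary using (Dec; yes; no; does; ¬_)
open import Relation.Nullary.Decidable using (dec-true; dec-false; does-⇔)

open ≡-Reasoning

does≡true⇒ : ∀ {P : Set} (P? : Dec P) → does P? ≡ true → P
does≡true⇒ (yes p) _ = p

does≡false⇒¬ : ∀ {P : Set} (P? : Dec P) → does P? ≡ false → ¬ P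
does≡false⇒¬ (no ¬p) _ = ¬p

bit : Bool → ℕ
bit false = 0
bit true = 1

bit-injective : ∀ {a b} → bit a ≡ bit b → a ≡ b
bit-injective {false} {false} _ = refl
bit-injective {true} {true} _ = refl

parity : ℕ → Bool
parity zero = false
parity (suc k) = not (parity k)

bit-parity : ∀ {k} → k ≤ 1 → bit (parity k) ≡ k
bit-parity z≤n = refl
bit-parity (s≤s z≤n) = refl

xor-not : ∀ b → b xor not b ≡ true
xor-not b = trans (sym (not-distribʳ-xor b b)) (cong not (xor-same b))

lookup-injective : ∀ {A : Set} {xs : List A} → Unique xs → ∀ {a b} → lookup xs a ≡ lookup xs b → a ≡ b
lookup-injective (_ ∷ _) {zero} {zero} _ = refl
lookup-injective (x∉xs ∷ _) {zero} {suc b} eq = ⊥-elim (All.lookup x∉xs (∈-lookup b) eq)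
lookup-injective (x∉xs ∷ _) {suc a} {zero} eq = ⊥-elim (All.lookup x∉xs (∈-lookup a) (sym eq))
lookup-injective (_ ∷ unique) {suc a} {suc b} eq = cong suc (lookup-injective unique eq)

occurrences-++ : ∀ {m} (j : Fin m) xs ys → occurrences j (xs ++ ys) ≡ occurrences j xs + occurrences j ys
occurrences-++ j xs ys = trans (cong length (filter-++ (j ≟_) xs ys)) (length-++ (filter (j ≟_) xs))

occurrences-∉ : ∀ {m} {j : Fin m} {xs} → j ∉ xs → occurrences j xs ≡ 0
occurrences-∉ {j = j} j∉xs = cong length (filter-none (j ≟_) (¬Any⇒All¬ _ j∉xs))

occurrences-concat : ∀ {m N} (j : Fin m) (xss : Fin N → List (Fin m)) →
  occurrences j (concat (tabulate xss)) ≡ sum (λ k → occurrences j (xss k))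
occurrences-concat {N = zero} j xss = refl
occurrences-concat {N = suc N} j xss =
  trans (occurrences-++ j (xss zero) _)
        (cong (occurrences j (xss zero) +_) (occurrences-concat j (xss ∘ suc)))

sum-zero : ∀ {n} (F : Fin n → ℕ) → (∀ x → F x ≡ 0) → sum F ≡ 0
sum-zero {n} F F≗0 = trans (sum-cong-≗ F≗0) (sum-replicate-zero n)

sum-single : ∀ {n} (F : Fin n → ℕ) (p : Fin n) → F p ≡ 1 → (∀ y → y ≢ p → F y ≡ 0) → sum F ≡ 1
sum-single {suc n} F p Fp≡1 F≡0 = begin
  sum F                          ≡⟨ sum-remove {i = p} F ⟩
  F p + sum (F ∘ punchIn p)      ≡⟨ cong₂ _+_ Fp≡1 (sum-zero _ (λ y → F≡0 _ (punchInᵢ≢i p y))) ⟩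
  1                              ∎

sum-pair : ∀ {n} (F : Fin n → ℕ) {a b : Fin n} → a ≢ b → F a ≡ 1 → F b ≡ 1 →
  (∀ y → y ≢ a → y ≢ b → F y ≡ 0) → sum F ≡ 2
sum-pair {suc n} F {a} {b} a≢b Fa≡1 Fb≡1 F≡0 = begin
  sum F                          ≡⟨ sum-remove {i = a} F ⟩
  F a + sum (F ∘ punchIn a)      ≡⟨ cong₂ _+_ Fa≡1 (sum-single _ (punchOut a≢b) Fb′≡1 F′≡0) ⟩
  2                              ∎
  where
  Fb′≡1 : F (punchIn a (punchOut a≢b)) ≡ 1
  Fb′≡1 = trans (cong F (punchIn-punchOut a≢b)) Fb≡1
  F′≡0 : ∀ y → y ≢ punchOut a≢b → F (punchIn a y) ≡ 0
  F′≡0 y y≢b′ = F≡0 _ (punchInᵢ≢i a y)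
    (λ eq → y≢b′ (punchIn-injective a y _ (trans eq (sym (punchIn-punchOut a≢b)))))

sum-agree-off : ∀ {n} (F G : Fin n → ℕ) (p : Fin n) → (∀ y → y ≢ p → F y ≡ G y) →
  sum F ≡ sum G → F p ≡ G p
sum-agree-off {suc n} F G p F≡G ΣF≡ΣG = +-cancelʳ-≡ (sum (G ∘ punchIn p)) (F p) (G p) (begin
  F p + sum (G ∘ punchIn p)  ≡⟨ cong (F p +_) (sum-cong-≗ (λ y → F≡G _ (punchInᵢ≢i p y))) ⟨
  F p + sum (F ∘ punchIn p)  ≡⟨ sum-remove {i = p} F ⟨
  sum F                      ≡⟨ ΣF≡ΣG ⟩
  sum G                      ≡⟨ sum-remove {i = p} G ⟩
  G p + sum (G ∘ punchIn p)  ∎)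

⟨$⟩ʳ-injective : ∀ {n} (π : Permutation′ n) {x y} → π ⟨$⟩ʳ x ≡ π ⟨$⟩ʳ y → x ≡ y
⟨$⟩ʳ-injective π eq = trans (sym (inverseˡ π)) (trans (cong (π ⟨$⟩ˡ_) eq) (inverseˡ π))

Invariant : ∀ {n} {A : Set} → Permutation′ n → (Fin n → A) → Set
Invariant π s = ∀ x → s (π ⟨$⟩ʳ x) ≡ s x

module _ {n : ℕ} (a b : Fin n) where

  transpose-matchˡ : transpose a b ⟨$⟩ʳ a ≡ b
  transpose-matchˡ rewrite dec-true (a ≟ a) refl = refl

  transpose-matchʳ : transpose a b ⟨$⟩ʳ b ≡ a
  transpose-matchʳ with b ≟ a
  ... | yes b≡a = b≡a
  ... | no _ rewrite dec-true (b ≟ b) refl = refl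

  transpose-fixes : ∀ {x} → x ≢ a → x ≢ b → transpose a b ⟨$⟩ʳ x ≡ x
  transpose-fixes {x} x≢a x≢b rewrite dec-false (x ≟ a) x≢a | dec-false (x ≟ b) x≢b = refl

  transpose-preserves : ∀ {A : Set} (c : Fin n → A) → c a ≡ c b → Invariant (transpose a b) c
  transpose-preserves c ca≡cb x with x ≟ a
  ... | yes refl = sym ca≡cb
  ... | no _ with x ≟ b
  ...   | yes refl = ca≡cb
  ...   | no _     = refl

changes : ∀ {n} → (Fin n → Bool) → Permutation′ n → ℕ
changes c π = sum λ x → bit (c x xor c (π ⟨$⟩ʳ x))

module _ {n : ℕ} (c : Fin n → Bool) where

  changes-transpose : ∀ {a b} → c b ≡ not (c a) → changes c (transpose a b) ≡ 2
  changes-transpose {a} {b} cb≡¬ca = sum-pair _ a≢b at-a at-b elsewhere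
    where
    a≢b : a ≢ b
    a≢b refl = not-¬ refl cb≡¬ca
    at-a : bit (c a xor c (transpose a b ⟨$⟩ʳ a)) ≡ 1
    at-a rewrite transpose-matchˡ a b | cb≡¬ca | xor-not (c a) = refl
    at-b : bit (c b xor c (transpose a b ⟨$⟩ʳ b)) ≡ 1
    at-b rewrite transpose-matchʳ a b | cb≡¬ca
               | sym (not-distribˡ-xor (c a) (c a)) | xor-same (c a) = refl
    elsewhere : ∀ y → y ≢ a → y ≢ b → bit (c y xor c (transpose a b ⟨$⟩ʳ y)) ≡ 0
    elsewhere y y≢a y≢b rewrite transpose-fixes a b y≢a y≢b | xor-same (c y) = refl

  changes-∘ₚ-invariant : ∀ π ρ → Invariant ρ c → changes c (π ∘ₚ ρ) ≡ changes c π
  changes-∘ₚ-invariant π ρ ρ-inv = sum-cong-≗ λ x → cong (λ z → bit (c x xor z)) (ρ-inv (π ⟨$⟩ʳ x))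

  changes-transpose-∘ₚ : ∀ {a b} π → c a ≡ c b → changes c (transpose a b ∘ₚ π) ≡ changes c π
  changes-transpose-∘ₚ {a} {b} π ca≡cb = sym (begin
    changes c π                                                       ≡⟨ sum-permute f (transpose a b) ⟩
    sum (λ x → f (transpose a b ⟨$⟩ʳ x))                              ≡⟨ sum-cong-≗ (λ x →
      cong (λ z → bit (z xor c (π ⟨$⟩ʳ (transpose a b ⟨$⟩ʳ x)))) (transpose-preserves a b c ca≡cb x)) ⟩
    changes c (transpose a b ∘ₚ π)                                    ∎)
    where
    f : Fin n → ℕ
    f y = bit (c y xor c (π ⟨$⟩ʳ y))

module _ {n : ℕ} {a b : Fin n} (π : Permutation′ n) (s : Fin n → Bool) where

  -- s and s ∘ π have equally many points with w = false, and there they can differ only at a.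
  transpose-∘ₚ-invariant⇒agree : (w : Fin n → Bool) → w a ≡ false → w b ≡ true → Invariant π w →
    Invariant (transpose a b ∘ₚ π) s → s a ≡ s b
  transpose-∘ₚ-invariant⇒agree w wa≡false wb≡true w-inv s-inv = bit-injective (begin
    bit (s a)                            ≡⟨ cong bit (∧-identityʳ (s a)) ⟨
    bit (s a ∧ not false)                ≡⟨ cong (λ z → bit (s a ∧ not z)) wa≡false ⟨
    F a                                  ≡⟨ sum-agree-off F G a agree ΣF≡ΣG ⟩
    G a                                  ≡⟨ cong (λ z → bit (s (π ⟨$⟩ʳ a) ∧ not z)) wa≡false ⟩
    bit (s (π ⟨$⟩ʳ a) ∧ not false)       ≡⟨ cong bit (∧-identityʳ _) ⟩
    bit (s (π ⟨$⟩ʳ a))                   ≡⟨ cong (λ z → bit (s (π ⟨$⟩ʳ z))) (transpose-matchʳ a b) ⟨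
    bit (s (π ⟨$⟩ʳ (transpose a b ⟨$⟩ʳ b))) ≡⟨ cong bit (s-inv b) ⟩
    bit (s b)                            ∎)
    where
    F G : Fin n → ℕ
    F y = bit (s y ∧ not (w y))
    G y = bit (s (π ⟨$⟩ʳ y) ∧ not (w y))
    ΣF≡ΣG : sum F ≡ sum G
    ΣF≡ΣG = trans (sum-permute F π) (sum-cong-≗ λ y → cong (λ z → bit (s (π ⟨$⟩ʳ y) ∧ not z)) (w-inv y))
    agree : ∀ y → y ≢ a → F y ≡ G y
    agree y y≢a with y ≟ b
    ... | yes refl rewrite wb≡true | ∧-zeroʳ (s y) | ∧-zeroʳ (s (π ⟨$⟩ʳ y)) = refl
    ... | no y≢b = cong (λ z → bit (z ∧ not (w y)))
                        (trans (sym (s-inv y)) (cong (λ z → s (π ⟨$⟩ʳ z)) (transpose-fixes a b y≢a y≢b)))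

  transpose-∘ₚ-invariant⇒invariant : s a ≡ s b → Invariant (transpose a b ∘ₚ π) s → Invariant π s
  transpose-∘ₚ-invariant⇒invariant sa≡sb s-inv x = begin
    s (π ⟨$⟩ʳ x)                          ≡⟨ cong (λ z → s (π ⟨$⟩ʳ z)) (inverseʳ (transpose a b)) ⟨
    s (π ⟨$⟩ʳ (transpose a b ⟨$⟩ʳ x′))    ≡⟨ s-inv x′ ⟩
    s x′                                  ≡⟨ transpose-preserves a b s sa≡sb x′ ⟨
    s (transpose a b ⟨$⟩ʳ x′)             ≡⟨ cong s (inverseʳ (transpose a b)) ⟩
    s x                                   ∎
    where
    x′ : Fin n
    x′ = transpose a b ⟨$⟩ˡ x

module SingleOrbit {n : ℕ} (π : Permutation′ n)
  (invariant⇒constant : ∀ (s : Fin n → Bool) → Invariant π s → ∀ x y → s x ≡ s y) where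

  orbit : Fin n → ℕ → Fin n
  orbit = iterate (π ⟨$⟩ʳ_)

  orbit-suc : ∀ x k → orbit x (suc k) ≡ π ⟨$⟩ʳ orbit x k
  orbit-suc x zero = refl
  orbit-suc x (suc k) = orbit-suc (π ⟨$⟩ʳ x) k

  orbit-+ : ∀ x a b → orbit x (a + b) ≡ orbit (orbit x a) b
  orbit-+ x zero b = refl
  orbit-+ x (suc a) b = orbit-+ (π ⟨$⟩ʳ x) a b

  orbit-cancel : ∀ {x y} k → orbit x k ≡ orbit y k → x ≡ y
  orbit-cancel zero eq = eq
  orbit-cancel (suc k) eq = ⟨$⟩ʳ-injective π (orbit-cancel k eq)

  repeat⇒period : ∀ x {a b} → a < b → orbit x a ≡ orbit x b → ∃ λ d → suc d ≤ b × orbit x (suc d) ≡ x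
  repeat⇒period x {a} a<b eq with m≤n⇒∃[o]m+o≡n a<b
  ... | d , refl = d , s≤s (m≤n+m d a) , orbit-cancel a (begin
    orbit (orbit x (suc d)) a  ≡⟨ orbit-+ x (suc d) a ⟨
    orbit x (suc (d + a))      ≡⟨ cong (orbit x ∘ suc) (+-comm d a) ⟩
    orbit x (suc (a + d))      ≡⟨ eq ⟨
    orbit x a                  ∎)

  module Period (x : Fin n) (d : ℕ) (period : orbit x (suc d) ≡ x) where

    Visited : Fin n → Set
    Visited y = ∃ λ (k : Fin (suc d)) → orbit x (toℕ k) ≡ y

    visited? : ∀ y → Dec (Visited y)
    visited? y = any? λ k → orbit x (toℕ k) ≟ y

    orbit-multiple : ∀ q → orbit x (q * suc d) ≡ x
    orbit-multiple zero = refl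
    orbit-multiple (suc q) = trans (orbit-+ x (suc d) (q * suc d))
                                   (trans (cong (λ y → orbit y (q * suc d)) period) (orbit-multiple q))

    visited : ∀ k → Visited (orbit x k)
    visited k = fromℕ< r<p , (begin
      orbit x (toℕ (fromℕ< r<p))                ≡⟨ cong (orbit x) (toℕ-fromℕ< r<p) ⟩
      orbit x r                                 ≡⟨ cong (λ y → orbit y r) (orbit-multiple q) ⟨
      orbit (orbit x (q * suc d)) r             ≡⟨ orbit-+ x (q * suc d) r ⟨
      orbit x (q * suc d + r)                   ≡⟨ cong (orbit x) (+-comm (q * suc d) r) ⟩
      orbit x (r + q * suc d)                   ≡⟨ cong (orbit x) (m≡m%n+[m/n]*n k (suc d)) ⟨
      orbit x k                                 ∎)
      where
      r q : ℕ
      r = k % suc d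
      q = k / suc d
      r<p : r < suc d
      r<p = m%n<n k (suc d)

    visited-step : ∀ {y} → Visited y → Visited (π ⟨$⟩ʳ y)
    visited-step (k , refl) = subst Visited (orbit-suc x (toℕ k)) (visited (suc (toℕ k)))

    visited-unstep : ∀ {y} → Visited (π ⟨$⟩ʳ y) → Visited y
    visited-unstep {y} (k , eq) = subst Visited (⟨$⟩ʳ-injective π (begin
      π ⟨$⟩ʳ orbit x (d + toℕ k)     ≡⟨ orbit-suc x (d + toℕ k) ⟨
      orbit x (suc d + toℕ k)        ≡⟨ orbit-+ x (suc d) (toℕ k) ⟩
      orbit (orbit x (suc d)) (toℕ k) ≡⟨ cong (λ z → orbit z (toℕ k)) period ⟩
      orbit x (toℕ k)                ≡⟨ eq ⟩
      π ⟨$⟩ʳ y                       ∎)) (visited (d + toℕ k))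

    all-visited : ∀ y → Visited y
    all-visited y = does≡true⇒ (visited? y) (trans (invariant⇒constant s s-invariant y x) x-visited)
      where
      s : Fin n → Bool
      s z = does (visited? z)
      s-invariant : Invariant π s
      s-invariant z = sym (does-⇔ (mk⇔ visited-step visited-unstep) (visited? z) (visited? (π ⟨$⟩ʳ z)))
      x-visited : s x ≡ true
      x-visited = dec-true (visited? x) (zero , refl)

    n≤period : n ≤ suc d
    n≤period = injective⇒≤ {f = proj₁ ∘ all-visited} λ {y} {z} eq →
      trans (sym (proj₂ (all-visited y))) (trans (cong (orbit x ∘ toℕ) eq) (proj₂ (all-visited z)))

  period-exists : ∀ x → ∃ λ d → suc d ≤ n × orbit x (suc d) ≡ x
  period-exists x with pigeonhole (n<1+n n) (orbit x ∘ toℕ)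
  ... | a , b , a<b , eq with repeat⇒period x a<b eq
  ... | d , d<b , period = d , ≤-trans d<b (toℕ≤pred[n] b) , period

  orbit-surjective : ∀ x y → ∃ λ (k : Fin n) → orbit x (toℕ k) ≡ y
  orbit-surjective x y with period-exists x
  ... | d , d<n , period with Period.all-visited x d period y
  ... | k , eq = inject≤ k d<n , trans (cong (orbit x) (toℕ-inject≤ k d<n)) eq

  no-early-return : ∀ x {a b : Fin n} → toℕ a < toℕ b → orbit x (toℕ a) ≢ orbit x (toℕ b)
  no-early-return x {a} {b} a<b eq with repeat⇒period x a<b eq
  ... | d , d<b , period =
    <-irrefl refl (≤-<-trans (≤-trans (Period.n≤period x d period) d<b) (toℕ<n b))

  orbit-injective : ∀ x {a b : Fin n} → orbit x (toℕ a) ≡ orbit x (toℕ b) → a ≡ b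
  orbit-injective x {a} {b} eq with <-cmp a b
  ... | tri< a<b _ _ = ⊥-elim (no-early-return x a<b eq)
  ... | tri≈ _ a≡b _ = a≡b
  ... | tri> _ _ b<a = ⊥-elim (no-early-return x b<a (sym eq))

  orbitPermutation : Fin n → Permutation′ n
  orbitPermutation x = permutation (orbit x ∘ toℕ) (proj₁ ∘ orbit-surjective x)
    (proj₂ ∘ orbit-surjective x) (λ k → orbit-injective x (proj₂ (orbit-surjective x _)))

module Walks {n m : ℕ} (σ : EdgeSeq n m) where

  Joins-sym : ∀ {j x y} → Joins σ j x y → Joins σ j y x
  Joins-sym (inj₁ e) = inj₂ e
  Joins-sym (inj₂ e) = inj₁ e

  Joins-elim : ∀ {j} (R : Fin n → Fin n → Set) → (∀ {x y} → R x y → R y x) →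
    R (proj₁ (σ j)) (proj₂ (σ j)) → ∀ {x y} → Joins σ j x y → R x y
  Joins-elim R R-sym r (inj₁ e) = subst (uncurry R) e r
  Joins-elim R R-sym r (inj₂ e) = R-sym (subst (uncurry R) e r)

  constant-along-walk : ∀ {A : Set} (s : Fin n → A) → (∀ j → s (proj₁ (σ j)) ≡ s (proj₂ (σ j))) →
    ∀ {x y} → Walk σ x y → s x ≡ s y
  constant-along-walk s s-edge [] = refl
  constant-along-walk s s-edge (step j jxz w) =
    trans (Joins-elim (λ x z → s x ≡ s z) sym (s-edge j) jxz) (constant-along-walk s s-edge w)

  infixr 5 _▷_
  _▷_ : ∀ {x y z} → Walk σ x y → Walk σ y z → Walk σ x z
  [] ▷ q = q
  step j jxw p ▷ q = step j jxw (p ▷ q)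

  edgesOf-▷ : ∀ {x y z} (p : Walk σ x y) (q : Walk σ y z) → edgesOf σ (p ▷ q) ≡ edgesOf σ p ++ edgesOf σ q
  edgesOf-▷ [] q = refl
  edgesOf-▷ (step j _ p) q = cong (j ∷_) (edgesOf-▷ p q)

  ∈-edgesOf-▷⁻ : ∀ {e x y z} (p : Walk σ x y) (q : Walk σ y z) → e ∈ edgesOf σ (p ▷ q) →
    e ∈ edgesOf σ p ⊎ e ∈ edgesOf σ q
  ∈-edgesOf-▷⁻ p q e∈ = ∈-++⁻ (edgesOf σ p) (subst (_ ∈_) (edgesOf-▷ p q) e∈)

  reverse : ∀ {x y} → Walk σ x y → Walk σ y x
  reverse [] = []
  reverse (step j jxw p) = reverse p ▷ step j (Joins-sym jxw) []

  edgesOf-reverse : ∀ {x y} (p : Walk σ x y) → edgesOf σ (reverse p) ⊆ edgesOf σ p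
  edgesOf-reverse (step j jxw p) e∈ with ∈-edgesOf-▷⁻ (reverse p) (step j (Joins-sym jxw) []) e∈
  ... | inj₁ e∈p = there (edgesOf-reverse p e∈p)
  ... | inj₂ (here e≡j) = here e≡j

  start∈verticesOf : ∀ {x y} (p : Walk σ x y) → x ∈ verticesOf σ p
  start∈verticesOf [] = here refl
  start∈verticesOf (step _ _ _) = here refl

  end∈verticesOf : ∀ {x y} (p : Walk σ x y) → y ∈ verticesOf σ p
  end∈verticesOf [] = here refl
  end∈verticesOf (step _ _ p) = there (end∈verticesOf p)

  endpoints∈verticesOf : ∀ {j x y} (p : Walk σ x y) → j ∈ edgesOf σ p →
    proj₁ (σ j) ∈ verticesOf σ p × proj₂ (σ j) ∈ verticesOf σ p
  endpoints∈verticesOf (step j (inj₁ e) p) (here refl) =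
    here (cong proj₁ e) , there (subst (_∈ verticesOf σ p) (sym (cong proj₂ e)) (start∈verticesOf p))
  endpoints∈verticesOf (step j (inj₂ e) p) (here refl) =
    there (subst (_∈ verticesOf σ p) (sym (cong proj₁ e)) (start∈verticesOf p)) , here (cong proj₂ e)
  endpoints∈verticesOf (step _ _ p) (there j∈p) with endpoints∈verticesOf p j∈p
  ... | u∈p , v∈p = there u∈p , there v∈p

  path-loop-edgeless : ∀ {x} (p : Walk σ x x) → IsPath σ p → edgesOf σ p ≡ []
  path-loop-edgeless [] _ = refl
  path-loop-edgeless (step _ _ p) (x∉p ∷ _) = ⊥-elim (All.lookup x∉p (end∈verticesOf p) refl)

  path-edge-unrepeated : ∀ {j x z y} (jxz : Joins σ j x z) (q : Walk σ z y) →
    IsPath σ (step j jxz q) → j ∉ edgesOf σ q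
  path-edge-unrepeated (inj₁ e) q (x∉q ∷ _) j∈q =
    All.lookup x∉q (subst (_∈ _) (cong proj₁ e) (proj₁ (endpoints∈verticesOf q j∈q))) refl
  path-edge-unrepeated (inj₂ e) q (x∉q ∷ _) j∈q =
    All.lookup x∉q (subst (_∈ _) (cong proj₂ e) (proj₂ (endpoints∈verticesOf q j∈q))) refl

  suffixFrom : ∀ {x y z} (p : Walk σ x y) → z ∈ verticesOf σ p →
    Σ (Walk σ z y) λ q → (IsPath σ p → IsPath σ q) × edgesOf σ q ⊆ edgesOf σ p
  suffixFrom [] (here refl) = [] , (λ p-path → p-path) , (λ ())
  suffixFrom (step j jxw p) (here refl) = step j jxw p , (λ p-path → p-path) , (λ e∈ → e∈)
  suffixFrom (step j jxw p) (there z∈p) with suffixFrom p z∈p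
  ... | q , q-path , q⊆p = q , (λ { (_ ∷ p-path) → q-path p-path }) , there ∘ q⊆p

  toPath : ∀ {x y} (w : Walk σ x y) → Σ (Walk σ x y) λ p → IsPath σ p × edgesOf σ p ⊆ edgesOf σ w
  toPath [] = [] , ([] ∷ []) , (λ ())
  toPath {x} (step j jxz w) with toPath w
  ... | p , p-path , p⊆w with Any.any? (x ≟_) (verticesOf σ p)
  ... | yes x∈p with suffixFrom p x∈p
  ...   | q , q-path , q⊆p = q , q-path p-path , there ∘ p⊆w ∘ q⊆p
  toPath (step j jxz w) | p , p-path , p⊆w | no x∉p =
    step j jxz p , (¬Any⇒All¬ _ x∉p ∷ p-path) , λ { (here e) → here e ; (there e∈p) → there (p⊆w e∈p) }

  length-verticesOf : ∀ {x y} (p : Walk σ x y) → length (verticesOf σ p) ≡ suc (length (edgesOf σ p))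
  length-verticesOf [] = refl
  length-verticesOf (step _ _ p) = cong suc (length-verticesOf p)

  lookup-verticesOf-first : ∀ {x y} (p : Walk σ x y) a → toℕ a ≡ 0 → lookup (verticesOf σ p) a ≡ x
  lookup-verticesOf-first [] zero _ = refl
  lookup-verticesOf-first (step _ _ _) zero _ = refl

  lookup-verticesOf-last : ∀ {x y} (p : Walk σ x y) a → suc (toℕ a) ≡ length (verticesOf σ p) →
    lookup (verticesOf σ p) a ≡ y
  lookup-verticesOf-last [] zero _ = refl
  lookup-verticesOf-last (step _ _ p) zero eq =
    ⊥-elim (0≢1+n (trans (suc-injective eq) (length-verticesOf p)))
  lookup-verticesOf-last (step _ _ p) (suc a) eq = lookup-verticesOf-last p a (suc-injective eq)

  lookup-verticesOf-adjacent : ∀ {x y} (p : Walk σ x y) a b → suc (toℕ a) ≡ toℕ b →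
    Adjacent σ (lookup (verticesOf σ p) a) (lookup (verticesOf σ p) b)
  lookup-verticesOf-adjacent [] zero zero ()
  lookup-verticesOf-adjacent (step j jxz p) zero (suc b) eq =
    j , subst (Joins σ j _) (sym (lookup-verticesOf-first p b (sym (suc-injective eq)))) jxz
  lookup-verticesOf-adjacent (step _ _ p) (suc a) (suc b) eq =
    lookup-verticesOf-adjacent p a b (suc-injective eq)

  pathCycle : ∀ {x y} (p : Walk σ x y) → IsPath σ p → 2 ≤ length (edgesOf σ p) → Adjacent σ y x → Cycle σ
  pathCycle p p-path 2≤len y~x = record
    { len = length (verticesOf σ p)
    ; len≥3 = subst (3 ≤_) (sym (length-verticesOf p)) (s≤s 2≤len)
    ; c = lookup (verticesOf σ p)
    ; distinct = λ a b → lookup-injective p-path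
    ; consecutive = lookup-verticesOf-adjacent p
    ; closing = λ a b a-last b-first →
        subst₂ (Adjacent σ) (sym (lookup-verticesOf-last p a a-last))
                            (sym (lookup-verticesOf-first p b b-first)) y~x
    }

  record Through (j : Fin m) (x y : Fin n) : Set where
    field
      {s t}    : Fin n
      before   : Walk σ x s
      jst      : Joins σ j s t
      after    : Walk σ t y
      j∉before : j ∉ edgesOf σ before
      j∉after  : j ∉ edgesOf σ after

  splitAt : ∀ {j x y} (p : Walk σ x y) → IsPath σ p → j ∈ edgesOf σ p → Through j x y
  splitAt {j} (step k kxz p) p-path j∈ with j ≟ k | j∈ | p-path
  ... | yes refl | _ | _ = record
    { before = [] ; jst = kxz ; after = p ; j∉before = λ () ; j∉after = path-edge-unrepeated kxz p p-path }
  ... | no j≢k | here j≡k  | _ = ⊥-elim (j≢k j≡k)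
  ... | no j≢k | there j∈p | _ ∷ p-path′ = record
    { before = step k kxz before ; jst = jst ; after = after
    ; j∉before = λ { (here j≡k) → j≢k j≡k ; (there j∈) → j∉before j∈ }
    ; j∉after = j∉after
    }
    where
    through = splitAt p p-path′ j∈p
    open Through through

module Forest {n m : ℕ} (σ : EdgeSeq n m) (simple : Simple σ) (acyclic : Acyclic σ) where

  open Walks σ

  Joins-irreflexive : ∀ {j x} → ¬ Joins σ j x x
  Joins-irreflexive {j} jxx = Joins-elim (λ x y → x ≢ y) (_∘ sym) (proj₁ simple j) jxx refl

  Joins-unique : ∀ {j k x y} → Joins σ k x y → Joins σ j x y → k ≡ j
  Joins-unique {j} {k} kxy jxy =
    Joins-elim (λ x y → Joins σ k x y → k ≡ j) (_∘ Joins-sym) (proj₂ simple k j) jxy kxy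

  edge∈path : ∀ {j x y} → Joins σ j x y → (p : Walk σ y x) → IsPath σ p → j ∈ edgesOf σ p
  edge∈path jxx [] _ = ⊥-elim (Joins-irreflexive jxx)
  edge∈path jxy (step k kyx []) _ = here (sym (Joins-unique (Joins-sym kyx) jxy))
  edge∈path {j} jxy p@(step _ _ (step _ _ _)) p-path =
    ⊥-elim (acyclic (pathCycle p p-path (s≤s (s≤s z≤n)) (j , jxy)))

  edge∈walk : ∀ {j x y} → Joins σ j x y → (w : Walk σ y x) → j ∈ edgesOf σ w
  edge∈walk jxy w with toPath w
  ... | p , p-path , p⊆w = p⊆w (edge∈path jxy p p-path)

module Tree {n m : ℕ} (σ : EdgeSeq n m) (tree : IsTree σ) where

  private
    simple : Simple σ
    simple = proj₁ tree
    connected : Connected σ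
    connected = proj₁ (proj₂ tree)
    acyclic : Acyclic σ
    acyclic = proj₂ (proj₂ tree)

  open Walks σ
  open Forest σ simple acyclic

  pathTo : (j : Fin m) (x : Fin n) → Walk σ x (proj₁ (σ j))
  pathTo j x = proj₁ (connected x (proj₁ (σ j)))

  -- side j is the indicator of the component of T − j not containing proj₁ (σ j).
  side : Fin m → Fin n → Bool
  side j x = does (Any.any? (j ≟_) (edgesOf σ (pathTo j x)))

  ∈-pathTo : ∀ {j x} → side j x ≡ true → j ∈ edgesOf σ (pathTo j x)
  ∈-pathTo = does≡true⇒ (Any.any? _ _)

  ∉-pathTo : ∀ {j x} → side j x ≡ false → j ∉ edgesOf σ (pathTo j x)
  ∉-pathTo = does≡false⇒¬ (Any.any? _ _)

  side-source : ∀ j → side j (proj₁ (σ j)) ≡ false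
  side-source j = cong (does ∘ Any.any? (j ≟_)) (path-loop-edgeless (pathTo j _) (proj₂ (connected _ _)))

  side-target : ∀ j → side j (proj₂ (σ j)) ≡ true
  side-target j = dec-true (Any.any? (j ≟_) _) (edge∈walk (inj₁ refl) (pathTo j _))

  Joins-source : ∀ {j s t} → σ j ≡ (s , t) → Joins σ j (proj₁ (σ j)) t
  Joins-source e = inj₁ (cong (_ ,_) (cong proj₂ e))

  -- Split the path from y at j: its second half, or its first half continued through k and the path
  -- from x, joins the endpoints of j without using j.
  no-crossing : ∀ {j k x y} → k ≢ j → Joins σ k x y →
    j ∉ edgesOf σ (pathTo j x) → j ∈ edgesOf σ (pathTo j y) → ⊥
  no-crossing {j} {k} {x} {y} k≢j kxy j∉x j∈y with splitAt (pathTo j y) (proj₂ (connected _ _)) j∈y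
  ... | record { jst = inj₁ e ; after = q₂ ; j∉after = j∉q₂ } = j∉q₂ (edge∈walk (Joins-source e) q₂)
  ... | record { s = s ; before = q₁ ; jst = inj₂ e ; j∉before = j∉q₁ } =
    j∉w (edge∈walk (Joins-source e) w)
    where
    w : Walk σ s (proj₁ (σ j))
    w = reverse q₁ ▷ step k (Joins-sym kxy) (pathTo j x)
    j∉w : j ∉ edgesOf σ w
    j∉w j∈w with ∈-edgesOf-▷⁻ (reverse q₁) _ j∈w
    ... | inj₁ j∈q₁        = j∉q₁ (edgesOf-reverse q₁ j∈q₁)
    ... | inj₂ (here j≡k)  = k≢j (sym j≡k)
    ... | inj₂ (there j∈x) = j∉x j∈x

  side-Joins : ∀ {j k x y} → k ≢ j → Joins σ k x y → side j x ≡ side j y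
  side-Joins {j} {k} {x} {y} k≢j kxy with side j x in sx | side j y in sy
  ... | false | false = refl
  ... | true  | true  = refl
  ... | false | true  = ⊥-elim (no-crossing k≢j kxy (∉-pathTo sx) (∈-pathTo sy))
  ... | true  | false = ⊥-elim (no-crossing k≢j (Joins-sym kxy) (∉-pathTo sy) (∈-pathTo sx))

  side-across : ∀ {j x y} → Joins σ j x y → side j x ≡ not (side j y)
  side-across {j} = Joins-elim (λ x y → side j x ≡ not (side j y))
    (λ e → trans (sym (not-involutive _)) (cong not (sym e)))
    (trans (side-source j) (cong not (sym (side-target j))))

  parity-occurrences : ∀ j {x y} (w : Walk σ x y) →
    parity (occurrences j (edgesOf σ w)) ≡ side j x xor side j y
  parity-occurrences j {x} [] = sym (xor-same (side j x))
  parity-occurrences j {x} {y} (step {w = z} k kxz w) with j ≟ k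
  ... | yes refl = begin
    not (parity (occurrences j (edgesOf σ w)))  ≡⟨ cong not (parity-occurrences j w) ⟩
    not (side j z xor side j y)                 ≡⟨ not-distribˡ-xor (side j z) (side j y) ⟩
    not (side j z) xor side j y                 ≡⟨ cong (_xor side j y) (side-across kxz) ⟨
    side j x xor side j y                       ∎
  ... | no j≢k = trans (parity-occurrences j w) (cong (_xor side j y) (sym (side-Joins (j≢k ∘ sym) kxz)))

  occurrences-path≤1 : ∀ j {x y} (p : Walk σ x y) → IsPath σ p → occurrences j (edgesOf σ p) ≤ 1
  occurrences-path≤1 j [] _ = z≤n
  occurrences-path≤1 j (step k kxz p) p-path with j ≟ k | p-path
  ... | yes refl | _ = s≤s (≤-reflexive (occurrences-∉ (path-edge-unrepeated kxz p p-path)))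
  ... | no _ | _ ∷ p-path′ = occurrences-path≤1 j p p-path′

  occurrences-path : ∀ j {x y} (p : Walk σ x y) → IsPath σ p →
    occurrences j (edgesOf σ p) ≡ bit (side j x xor side j y)
  occurrences-path j p p-path =
    trans (sym (bit-parity (occurrences-path≤1 j p p-path))) (cong bit (parity-occurrences j p))

  edgeTransposition-preserves-side : ∀ {j k} → k ≢ j → Invariant (edgeTransposition σ k) (side j)
  edgeTransposition-preserves-side {j} k≢j = transpose-preserves _ _ (side j) (side-Joins k≢j (inj₁ refl))

  productFrom-preserves-side : ∀ {j} L → All (j ≢_) L → Invariant (productFrom σ L) (side j)
  productFrom-preserves-side [] [] x = refl
  productFrom-preserves-side (k ∷ L) (j≢k ∷ j∉L) x =
    trans (productFrom-preserves-side L j∉L _) (edgeTransposition-preserves-side (j≢k ∘ sym) x)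

  changes-side-productFrom : ∀ {j} L → Unique L → j ∈ L → changes (side j) (productFrom σ L) ≡ 2
  changes-side-productFrom {j} (k ∷ L) (k∉L ∷ _) (here refl) =
    trans (changes-∘ₚ-invariant (side j) (edgeTransposition σ j) (productFrom σ L)
                                (productFrom-preserves-side L k∉L))
          (changes-transpose (side j) (trans (side-target j) (cong not (sym (side-source j)))))
  changes-side-productFrom {j} (k ∷ L) (k∉L ∷ L-unique) (there j∈L) =
    trans (changes-transpose-∘ₚ (side j) (productFrom σ L) (side-Joins (All.lookup k∉L j∈L) (inj₁ refl)))
          (changes-side-productFrom L L-unique j∈L)

  invariant⇒agree-on-edges : ∀ L → Unique L → (s : Fin n → Bool) → Invariant (productFrom σ L) s →
    All (λ j → s (proj₁ (σ j)) ≡ s (proj₂ (σ j))) L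
  invariant⇒agree-on-edges [] [] s _ = []
  invariant⇒agree-on-edges (k ∷ L) (k∉L ∷ L-unique) s s-inv =
    agree ∷ invariant⇒agree-on-edges L L-unique s
              (transpose-∘ₚ-invariant⇒invariant (productFrom σ L) s agree s-inv)
    where
    agree : s (proj₁ (σ k)) ≡ s (proj₂ (σ k))
    agree = transpose-∘ₚ-invariant⇒agree (productFrom σ L) s (side k) (side-source k) (side-target k)
              (productFrom-preserves-side L k∉L) s-inv

  invariant⇒constant : ∀ s → Invariant (product σ) s → ∀ x y → s x ≡ s y
  invariant⇒constant s s-inv x y =
    constant-along-walk s (λ j → All.lookup agree (∈-allFin j)) (proj₁ (connected x y))
    where
    agree : All (λ j → s (proj₁ (σ j)) ≡ s (proj₂ (σ j))) (allFin m)
    agree = invariant⇒agree-on-edges (allFin m) (allFin⁺ m) s s-inv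

-- For n ≤ 1 there is no edge e.
lemma2p1 : (n : ℕ) → 2 ≤ n → (σ : EdgeSeq n (n ∸ 1)) → IsTree σ → (i : Fin n)
    → (P : (k : Fin n) → Σ (Walk σ (actPow σ i (toℕ k)) (actPow σ i (suc (toℕ k)))) (IsPath σ))
    → (e : Fin (n ∸ 1))
    → occurrences e (concat (map (λ k → edgesOf σ (proj₁ (P k))) (allFin n))) ≡ 2
lemma2p1 n _ σ tree i P e = begin
  occurrences e (concat (map walkEdges (allFin n)))  ≡⟨ cong (occurrences e ∘ concat) (map-tabulate id walkEdges) ⟩
  occurrences e (concat (tabulate walkEdges))        ≡⟨ occurrences-concat e walkEdges ⟩
  sum (occurrences e ∘ walkEdges)                    ≡⟨ sum-cong-≗ occurrences-walk ⟩
  sum (λ (k : Fin n) → crossing (orbit i (toℕ k)))  ≡⟨ sum-permute crossing (orbitPermutation i) ⟨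
  changes (side e) (product σ)                       ≡⟨ changes-side-productFrom (allFin m) (allFin⁺ m) (∈-allFin e) ⟩
  2                                                  ∎
  where
  m : ℕ
  m = n ∸ 1
  open Tree σ tree
  open SingleOrbit (product σ) invariant⇒constant
  walkEdges : Fin n → List (Fin m)
  walkEdges k = edgesOf σ (proj₁ (P k))
  crossing : Fin n → ℕ
  crossing x = bit (side e x xor side e (product σ ⟨$⟩ʳ x))
  occurrences-walk : ∀ k → occurrences e (walkEdges k) ≡ crossing (orbit i (toℕ k))
  occurrences-walk k = trans (occurrences-path e (proj₁ (P k)) (proj₂ (P k)))
    (cong (λ y → bit (side e (orbit i (toℕ k)) xor side e y)) (orbit-suc i (toℕ k)))
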